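{- Let $F$ be a tract with a fixed involution, and let $M$ and $N$ be $F$-matroids on $E=\{1,\dots,n\}$. Then $N\twoheadrightarrow M$ if and only if $M^*\twoheadrightarrow N^*$.
   Context: A tract is a commutative multiplicative monoid $F$ with identity $1$ and absorbing element $0$ such that $F^\times=F\setminus\{0\}$ is a group, together with a subset $N_F\subseteq\mathbb{N}[F^\times]$ (the nullset) such that $0\in N_F$, $1\notin N_F$, there is a unique $\epsilon\in F^\times$ with $1+\epsilon\in N_F$, and $N_F$ is stable under multiplication by $F^\times$. An involution is a tract morphism $\tau:F\to F$ (multiplicative, $\tau(0)=0$, $\tau(1)=1$, preserving nullsets) with $\tau^2=\mathrm{id}$; write $\overline x=\tau(x)$. A Grassmann–Plücker function of rank $r$ on $E$ is a map $\varphi:E^r\to F$, not identically zero, alternating (swapping two arguments multiplies the value by $\epsilon$; value $0$ if two arguments coincide), with $\sum_{k=1}^{r+1}\epsilon^k\varphi(y_1,\dots,\widehat{y_k},\dots,y_{r+1})\varphi(y_k,x_1,\dots,x_{r-1})\in N_F$ for all $x_i,y_j\in E$. An $F$-matroid of rank $r$ is a class $[\varphi]$ modulo multiplication by $F^\times$. Its dual $M^*$ is the $F$-matroid of rank $n-r$ represented by $\varphi^*(x_1,\dots,x_{n-r})=\mathrm{sign}(x_1,\dots,x_{n-r},x'_1,\dots,x'_r)\,\overline{\varphi(x'_1,\dots,x'_r)}$ whenever $E=\{x_1,\dots,x_{n-r},x'_1,\dots,x'_r\}$ (and $0$ otherwise), where $\mathrm{sign}$ is the sign of the permutation sorting the tuple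 increasingly, with $-1$ read as $\epsilon$. If $M=[\mu]$, $N=[\nu]$ have ranks $r,w$, then $N\twoheadrightarrow M$ means $\sum_{k=1}^{w+1}\epsilon^k\nu(y_1,\dots,\widehat{y_k},\dots,y_{w+1})\mu(y_k,x_1,\dots,x_{r-1})\in N_F$ for all $y_1,\dots,y_{w+1},x_1,\dots,x_{r-1}\in E$. -}

module Defs where

open import Data.Nat using (ℕ; zero; suc; _+_; _∸_)
open import Data.Fin using (Fin; toℕ; _<?_)
open import Data.Vec using (Vec; _∷_; []; lookup; removeAt; tabulate; toList; _[_]≔_; _++_)
open import Data.List as List using (List; map; allFin)
open import Data.List.Relation.Unary.All using (All)
open import Data.List.Relation.Binary.Permutation.Propositional using (_↭_)
open import Data.Product using (Σ; ∃; _×_; _,_)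
open import Data.Unit using (⊤)
open import Data.Bool using (if_then_else_)
open import Relation.Nullary using (¬_; does)
open import Relation.Binary.PropositionalEquality using (_≡_; _≢_)

-- Tracts.  Formal sums in ℕ[F^×] are represented by lists (multisets
-- up to permutation, see Null-↭); only lists of nonzero elements are
-- meaningful, and the axioms only constrain those.

record Tract : Set₁ where
  infixl 7 _·_
  field
    Carrier   : Set
    _·_       : Carrier → Carrier → Carrier
    1#        : Carrier
    0#        : Carrier
    ·-assoc   : ∀ x y z → (x · y) · z ≡ x · (y · z)
    ·-comm    : ∀ x y → x · y ≡ y · x
    ·-identityˡ : ∀ x → 1# · x ≡ x
    ·-zeroˡ   : ∀ x → 0# · x ≡ 0#
    1≢0       : 1# ≢ 0#
    inverse   : ∀ x → x ≢ 0# → Σ Carrier (λ y → x · y ≡ 1#)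
    Null      : List Carrier → Set
    Null-↭    : ∀ {xs ys} → All (_≢ 0#) xs → xs ↭ ys → Null xs → Null ys
    Null-0    : Null List.[]
    ¬Null-1   : ¬ Null (1# List.∷ List.[])
    ε         : Carrier
    ε≢0       : ε ≢ 0#
    Null-1+ε  : Null (1# List.∷ ε List.∷ List.[])
    ε-unique  : ∀ δ → δ ≢ 0# → Null (1# List.∷ δ List.∷ List.[]) → δ ≡ ε
    Null-scale : ∀ x xs → x ≢ 0# → All (_≢ 0#) xs → Null xs → Null (map (x ·_) xs)

record Involution (T : Tract) : Set where
  open Tract T
  field
    τ       : Carrier → Carrier
    τ-·     : ∀ x y → τ (x · y) ≡ τ x · τ y
    τ-0     : τ 0# ≡ 0#
    τ-1     : τ 1# ≡ 1#
    τ-Null  : ∀ xs → All (_≢ 0#) xs → Null xs → Null (map τ xs)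
    τ-invol : ∀ x → τ (τ x) ≡ x

module _ (T : Tract) where
  open Tract T

  data Drop0 : List Carrier → List Carrier → Set where
    nil  : Drop0 List.[] List.[]
    keep : ∀ {x xs ys} → x ≢ 0# → Drop0 xs ys → Drop0 (x List.∷ xs) (x List.∷ ys)
    drop : ∀ {x xs ys} → x ≡ 0# → Drop0 xs ys → Drop0 (x List.∷ xs) ys

  -- the formal sum Σ xs (terms in F, zero terms discarded) lies in N_F
  InN : List Carrier → Set
  InN xs = Σ (List Carrier) (λ ys → Drop0 xs ys × Null ys)

  _^ε_ : ℕ → Carrier
  _^ε_ zero    = 1#
  _^ε_ (suc k) = ε · _^ε_ k

  module _ {n : ℕ} where

    -- The condition  N ↠ M  for representatives ν (rank w) and μ (rank r):
    --  Σ_{k=1}^{w+1} ε^k ν(y₁..ŷ_k..y_{w+1}) μ(y_k,x₁..x_{r-1}) ∈ N_F.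
    Quot : ∀ {w r} → (Vec (Fin n) w → Carrier) → (Vec (Fin n) r → Carrier) → Set
    Quot {w} {zero}   ν μ = ⊤
    Quot {w} {suc r'} ν μ =
      ∀ (y : Vec (Fin n) (suc w)) (x : Vec (Fin n) r') →
        InN (toList (tabulate (λ (k : Fin (suc w)) →
               _^ε_ (suc (toℕ k)) · ν (removeAt y k) · μ (lookup y k ∷ x))))

    record IsGP {r : ℕ} (φ : Vec (Fin n) r → Carrier) : Set where
      field
        nonzero   : Σ (Vec (Fin n) r) (λ x → φ x ≢ 0#)
        alt-swap  : ∀ (x : Vec (Fin n) r) (i j : Fin r) → i ≢ j →
                      φ ((x [ i ]≔ lookup x j) [ j ]≔ lookup x i) ≡ ε · φ x
        alt-zero  : ∀ (x : Vec (Fin n) r) (i j : Fin r) → i ≢ j →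
                      lookup x i ≡ lookup x j → φ x ≡ 0#
        GP        : Quot φ φ

  countBelow : ∀ {n} → Fin n → List (Fin n) → ℕ
  countBelow a List.[] = 0
  countBelow a (b List.∷ bs) = if does (b <? a) then suc (countBelow a bs) else countBelow a bs

  inversions : ∀ {n} → List (Fin n) → ℕ
  inversions List.[] = 0
  inversions (a List.∷ as) = countBelow a as + inversions as

  -- sign of a sequence (a permutation of E) with -1 read as ε
  sign : ∀ {n} → List (Fin n) → Carrier
  sign xs = _^ε_ (inversions xs)

  record IsDual (I : Involution T) {n r : ℕ}
                (φ : Vec (Fin n) r → Carrier)
                (ψ : Vec (Fin n) (n ∸ r) → Carrier) : Set where
    open Involution I
    field
      on-complement : ∀ (x : Vec (Fin n) (n ∸ r)) (x' : Vec (Fin n) r) →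
                        toList (x ++ x') ↭ allFin n →
                        ψ x ≡ sign (toList (x ++ x')) · τ (φ x')
      otherwise     : ∀ (x : Vec (Fin n) (n ∸ r)) →
                        (∀ (x' : Vec (Fin n) r) → ¬ (toList (x ++ x') ↭ allFin n)) →
                        ψ x ≡ 0#

-- If the tuple y of the relation has a repeated
-- entry, all terms vanish except two, which are u and ε·u; if the tuple x does, all terms vanish. Otherwise
-- complete to partitions E = ys ⊔ x = xs ⊔ y. The nonzero terms of N ↠ M at (y, x) and of M* ↠ N* at
-- (ys, xs) are then both indexed by the elements of y ∩ ys, and at each such element the dual term is
-- c · τ(primal term) for one constant c with c · c = 1 (a power of ε). Since v ↦ c · τ(v) and its inverse
-- preserve N_F, one sum lies in N_F iff the other does.

module Submission where

open import Defs
open import Algebra.Bundles using (CommutativeMonoid)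
import Algebra.Solver.CommutativeMonoid as CommutativeMonoidSolver
open import Data.Bool using (true; false)
open import Data.Empty using (⊥-elim)
open import Data.Fin using (Fin; zero; suc; toℕ; _≟_; _<?_)
import Data.Fin.Properties as Fin
open import Data.List as List using (List; []; _∷_; _++_; length; map; allFin; filter)
import Data.List.Properties as Listₚ
open import Data.List.Membership.Propositional using (_∈_; _∉_)
open import Data.List.Membership.Propositional.Properties
  using (∈-++⁻; ∈-++⁺ˡ; ∈-++⁺ʳ; ∈-∃++; ∈-map⁺; ∈-allFin; ∈-filter⁺; ∈-filter⁻; ∈-tabulate⁺; ∈-tabulate⁻)
open import Data.List.Membership.Propositional.Properties.WithK using (unique∧set⇒bag)
import Data.List.Membership.DecPropositional as DecMembership
open import Data.List.Relation.Binary.BagAndSetEquality using (∼bag⇒↭)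
import Data.List.Relation.Binary.Permutation.Propositional as Perm
open Perm using (_↭_; ↭-sym; ↭-refl; ↭-trans; ↭-prep; ↭-swap; ↭⇒↭ₛ)
open import Data.List.Relation.Binary.Permutation.Propositional.Properties
  using (shift; ++⁺ˡ; ++⁺ʳ; ++-comm; ∈-resp-↭; ↭-length)
import Data.List.Relation.Binary.Permutation.Setoid.Properties as PermSetoid
open import Data.List.Relation.Unary.All using (All; []; _∷_)
import Data.List.Relation.Unary.All as All
import Data.List.Relation.Unary.All.Properties as Allₚ
open import Data.List.Relation.Unary.Any using (here; there)
open import Data.List.Relation.Unary.Unique.Propositional using (Unique; []; _∷_)
import Data.List.Relation.Unary.Unique.Propositional.Properties as Unique
open import Data.Nat using (ℕ; zero; suc; _+_; _≤_; _<_; _∸_; s≤s; z≤n)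
import Data.Nat.Properties as ℕ
open import Algebra.Properties.CommutativeSemigroup ℕ.+-commutativeSemigroup using (x∙yz≈y∙xz)
open import Data.Product using (Σ; ∃; ∃₂; _×_; _,_; proj₁; proj₂)
open import Data.Sum using (_⊎_; inj₁; inj₂)
open import Data.Unit using (tt)
open import Data.Vec using (Vec; []; _∷_; lookup; removeAt; tabulate; toList; fromList) renaming (_++_ to _++ᵛ_)
import Data.Vec.Properties as Vec
open import Data.Vec.Membership.Propositional.Properties using (∈-lookup; ∈-toList⁺)
open import Function using (_⇔_; mk⇔; Equivalence; _∘_; id)
open import Function.Definitions using (Injective)
open import Relation.Nullary using (¬_; Dec; yes; no; ¬?; does)
open import Relation.Nullary.Decidable using (dec-true; dec-false)
open import Relation.Binary.Definitions using (tri<; tri≈; tri>)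
open import Relation.Binary.PropositionalEquality
open import Relation.Binary.PropositionalEquality.Properties using (setoid)

module _ {A : Set} where

  Unique-resp-↭ : ∀ {xs ys : List A} → xs ↭ ys → Unique xs → Unique ys
  Unique-resp-↭ p = PermSetoid.Unique-resp-↭ (setoid A) (↭⇒↭ₛ p)

  Unique-++⁻ˡ : ∀ (xs : List A) {ys} → Unique (xs ++ ys) → Unique xs
  Unique-++⁻ˡ []       _          = []
  Unique-++⁻ˡ (x ∷ xs) (x∉ ∷ u) = Allₚ.++⁻ˡ xs x∉ ∷ Unique-++⁻ˡ xs u

  Unique-++⁻ʳ : ∀ (xs : List A) {ys} → Unique (xs ++ ys) → Unique ys
  Unique-++⁻ʳ []       u        = u
  Unique-++⁻ʳ (x ∷ xs) (_ ∷ u) = Unique-++⁻ʳ xs u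

  Unique-shift : ∀ xs {a : A} {ys} → Unique (xs ++ a ∷ ys) → Unique (a ∷ xs ++ ys)
  Unique-shift xs {a} {ys} = Unique-resp-↭ (shift a xs ys)

  Unique-middle : ∀ xs {a : A} {ys} → Unique (xs ++ a ∷ ys) → All (a ≢_) (xs ++ ys)
  Unique-middle xs u with Unique-shift xs u
  ... | a∉ ∷ _ = a∉

  toList-tabulate : ∀ {m} (f : Fin m → A) → toList (tabulate f) ≡ List.tabulate f
  toList-tabulate {zero}  f = refl
  toList-tabulate {suc m} f = cong (f zero ∷_) (toList-tabulate (f ∘ suc))

  removeAt-split : ∀ {m} (v : Vec A (suc m)) (k : Fin (suc m)) →
                   ∃₂ λ P Q → toList v ≡ P ++ lookup v k ∷ Q × toList (removeAt v k) ≡ P ++ Q × length P ≡ toℕ k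
  removeAt-split (x ∷ xs)     zero    = [] , toList xs , refl , refl , refl
  removeAt-split (x ∷ y ∷ xs) (suc k) with removeAt-split (y ∷ xs) k
  ... | P , Q , v≡ , v∖k≡ , |P| = x ∷ P , Q , cong (x ∷_) v≡ , cong (x ∷_) v∖k≡ , cong suc |P|

  removeAt-↭ : ∀ {m} (v : Vec A (suc m)) k → lookup v k ∷ toList (removeAt v k) ↭ toList v
  removeAt-↭ v k with removeAt-split v k
  ... | P , Q , v≡ , v∖k≡ , _ = subst₂ (λ l l' → lookup v k ∷ l ↭ l') (sym v∖k≡) (sym v≡) (↭-sym (shift (lookup v k) P Q))

  removeAt-repeat : ∀ {m} (v : Vec A (suc m)) {i j : Fin (suc m)} → toℕ i < toℕ j → lookup v i ≡ lookup v j →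
                    ∃₂ λ P Q → ∃ λ R → toList (removeAt v i) ≡ P ++ Q ++ lookup v j ∷ R
                                     × toList (removeAt v j) ≡ P ++ lookup v j ∷ Q ++ R
                                     × suc (toℕ i) + length Q ≡ toℕ j
  removeAt-repeat (x ∷ y ∷ xs) {zero} {suc j} _ x≡ with removeAt-split (y ∷ xs) j
  ... | Q , R , v≡ , v∖j≡ , |Q| = [] , Q , R , v≡ , trans (cong (_∷ _) x≡) (cong (_ ∷_) v∖j≡) , cong suc |Q|
  removeAt-repeat (x ∷ y ∷ xs) {suc i} {suc j} (s≤s i<j) e≡ with removeAt-repeat (y ∷ xs) i<j e≡
  ... | P , Q , R , v∖i≡ , v∖j≡ , |Q| = x ∷ P , Q , R , cong (x ∷_) v∖i≡ , cong (x ∷_) v∖j≡ , cong suc |Q|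

  lookup-injective : ∀ {m} (v : Vec A m) → Unique (toList v) → ∀ {i j} → lookup v i ≡ lookup v j → i ≡ j
  lookup-injective (x ∷ v) u       {zero}  {zero}  _ = refl
  lookup-injective (x ∷ v) (x∉ ∷ u) {zero}  {suc j} e = ⊥-elim (All.lookup x∉ (∈-toList⁺ (∈-lookup j v)) e)
  lookup-injective (x ∷ v) (x∉ ∷ u) {suc i} {zero}  e = ⊥-elim (All.lookup x∉ (∈-toList⁺ (∈-lookup i v)) (sym e))
  lookup-injective (x ∷ v) (_ ∷ u)  {suc i} {suc j} e = cong suc (lookup-injective v u e)

  ∈-toList⇒lookup : ∀ {m} (v : Vec A m) {e} → e ∈ toList v → ∃ λ i → lookup v i ≡ e
  ∈-toList⇒lookup (x ∷ v) (here refl) = zero , refl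
  ∈-toList⇒lookup (x ∷ v) (there e∈v) with ∈-toList⇒lookup v e∈v
  ... | i , v[i]≡e = suc i , v[i]≡e

  toList-length : ∀ (c : List A) {m} → length c ≡ m → Σ (Vec A m) λ v → toList v ≡ c
  toList-length c refl = fromList c , Vec.toList∘fromList c

module TractProperties (T : Tract) where
  open Tract T public

  infix 8 ε^_
  ε^_ : ℕ → Carrier
  ε^ k = T ^ε k

  ·-identityʳ : ∀ x → x · 1# ≡ x
  ·-identityʳ x = trans (·-comm x 1#) (·-identityˡ x)

  ·-zeroʳ : ∀ x → x · 0# ≡ 0#
  ·-zeroʳ x = trans (·-comm x 0#) (·-zeroˡ x)

  ·-commutativeMonoid : CommutativeMonoid _ _
  ·-commutativeMonoid = record
    { isCommutativeMonoid = record
      { isMonoid = record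
        { isSemigroup = record
          { isMagma = record { isEquivalence = isEquivalence ; ∙-cong = cong₂ _·_ }
          ; assoc = ·-assoc }
        ; identity = ·-identityˡ , ·-identityʳ }
      ; comm = ·-comm } }

  open CommutativeMonoidSolver ·-commutativeMonoid public using (solve; _⊜_; _⊕_)

  ·-cancelˡ : ∀ {x y z} → x ≢ 0# → x · y ≡ x · z → y ≡ z
  ·-cancelˡ {x} {y} {z} x≢0 xy≡xz with inverse x x≢0
  ... | x⁻¹ , xx⁻¹≡1 = begin
    y              ≡⟨ sym (undo y) ⟩
    x⁻¹ · (x · y)  ≡⟨ cong (x⁻¹ ·_) xy≡xz ⟩
    x⁻¹ · (x · z)  ≡⟨ undo z ⟩
    z              ∎
    where
    open ≡-Reasoning
    undo : ∀ u → x⁻¹ · (x · u) ≡ u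
    undo u = trans (sym (·-assoc x⁻¹ x u))
                   (trans (cong (_· u) (trans (·-comm x⁻¹ x) xx⁻¹≡1)) (·-identityˡ u))

  ·-nonzero : ∀ {x y} → x ≢ 0# → y ≢ 0# → x · y ≢ 0#
  ·-nonzero {x} x≢0 y≢0 xy≡0 = y≢0 (·-cancelˡ x≢0 (trans xy≡0 (sym (·-zeroʳ x))))

  x·y≡0⇒x≡0 : ∀ {x y} → y ≢ 0# → x · y ≡ 0# → x ≡ 0#
  x·y≡0⇒x≡0 {x} {y} y≢0 xy≡0 = ·-cancelˡ y≢0 (trans (·-comm y x) (trans xy≡0 (sym (·-zeroʳ y))))

  -- The inverse δ of ε satisfies 1 + δ ∈ N_F (scale 1 + ε by δ), so δ = ε.
  ε·ε≡1 : ε · ε ≡ 1#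
  ε·ε≡1 with inverse ε ε≢0
  ... | δ , εδ≡1 = subst (λ u → ε · u ≡ 1#) δ≡ε εδ≡1
    where
    δ≢0 : δ ≢ 0#
    δ≢0 δ≡0 = 1≢0 (trans (sym εδ≡1) (trans (cong (ε ·_) δ≡0) (·-zeroʳ ε)))
    δ+1-null : Null (δ ∷ 1# ∷ [])
    δ+1-null = subst Null (cong₂ (λ u v → u ∷ v ∷ []) (·-identityʳ δ) (trans (·-comm δ ε) εδ≡1))
                 (Null-scale δ (1# ∷ ε ∷ []) δ≢0 (1≢0 ∷ ε≢0 ∷ []) Null-1+ε)
    δ≡ε : δ ≡ ε
    δ≡ε = ε-unique δ δ≢0 (Null-↭ (δ≢0 ∷ 1≢0 ∷ []) (↭-swap δ 1# ↭-refl) δ+1-null)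

  ε·ε·-cancel : ∀ x → ε · (ε · x) ≡ x
  ε·ε·-cancel x = trans (sym (·-assoc ε ε x)) (trans (cong (_· x) ε·ε≡1) (·-identityˡ x))

  Dec-zero-· : ∀ {x y} → Dec (x ≡ 0#) → Dec (y ≡ 0#) → Dec (x · y ≡ 0#)
  Dec-zero-· {x} {y} (yes x≡0) _       = yes (trans (cong (_· y) x≡0) (·-zeroˡ y))
  Dec-zero-· {x} {y} (no _)    (yes y≡0) = yes (trans (cong (x ·_) y≡0) (·-zeroʳ x))
  Dec-zero-·         (no x≢0)  (no y≢0)  = no (·-nonzero x≢0 y≢0)

  record PreservesNull (h : Carrier → Carrier) : Set where
    field
      map-nonzero : ∀ {x} → x ≢ 0# → h x ≢ 0#
      map-zero    : h 0# ≡ 0#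
      map-null    : ∀ xs → All (_≢ 0#) xs → Null xs → Null (map h xs)

  id-preservesNull : PreservesNull id
  id-preservesNull = record
    { map-nonzero = id ; map-zero = refl ; map-null = λ xs _ → subst Null (sym (Listₚ.map-id xs)) }

  ·-preservesNull : ∀ {c} → c ≢ 0# → PreservesNull (c ·_)
  ·-preservesNull {c} c≢0 = record
    { map-nonzero = ·-nonzero c≢0 ; map-zero = ·-zeroʳ c ; map-null = λ xs → Null-scale c xs c≢0 }

  ∘-preservesNull : ∀ {g h} → PreservesNull g → PreservesNull h → PreservesNull (g ∘ h)
  ∘-preservesNull {g} {h} pg ph = record
    { map-nonzero = G.map-nonzero ∘ H.map-nonzero
    ; map-zero    = trans (cong g H.map-zero) G.map-zero
    ; map-null    = λ xs xs≢0 null → subst Null (sym (Listₚ.map-∘ xs))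
                      (G.map-null (map h xs) (Allₚ.map⁺ (All.map H.map-nonzero xs≢0)) (H.map-null xs xs≢0 null)) }
    where
    module G = PreservesNull pg
    module H = PreservesNull ph

  ε^-nonzero : ∀ k → ε^ k ≢ 0#
  ε^-nonzero zero    = 1≢0
  ε^-nonzero (suc k) = ·-nonzero ε≢0 (ε^-nonzero k)

  ε^-+ : ∀ m n → ε^ (m + n) ≡ ε^ m · ε^ n
  ε^-+ zero    n = sym (·-identityˡ (ε^ n))
  ε^-+ (suc m) n = trans (cong (ε ·_) (ε^-+ m n)) (sym (·-assoc ε (ε^ m) (ε^ n)))

  ε^-square : ∀ k → ε^ k · ε^ k ≡ 1#
  ε^-square zero    = ·-identityˡ 1#
  ε^-square (suc k) = begin
    (ε · ε^ k) · (ε · ε^ k)    ≡⟨ solve 2 (λ e p → (e ⊕ p) ⊕ (e ⊕ p) ⊜ (e ⊕ e) ⊕ (p ⊕ p)) refl ε (ε^ k) ⟩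
    (ε · ε) · (ε^ k · ε^ k)    ≡⟨ cong₂ _·_ ε·ε≡1 (ε^-square k) ⟩
    1# · 1#                     ≡⟨ ·-identityˡ 1# ⟩
    1#                          ∎
    where open ≡-Reasoning

  ε^-flip : ∀ k {x y} → x ≡ ε^ k · y → y ≡ ε^ k · x
  ε^-flip k {x} {y} x≡ = sym (begin
    ε^ k · x             ≡⟨ cong (ε^ k ·_) x≡ ⟩
    ε^ k · (ε^ k · y)    ≡⟨ sym (·-assoc _ _ _) ⟩
    (ε^ k · ε^ k) · y    ≡⟨ cong (_· y) (ε^-square k) ⟩
    1# · y               ≡⟨ ·-identityˡ y ⟩
    y                    ∎)
    where open ≡-Reasoning

module InvolutionProperties {T : Tract} (I : Involution T) where
  open TractProperties T
  open Involution I public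

  τ-nonzero : ∀ {x} → x ≢ 0# → τ x ≢ 0#
  τ-nonzero {x} x≢0 τx≡0 = x≢0 (trans (sym (τ-invol x)) (trans (cong τ τx≡0) τ-0))

  τ-ε : τ ε ≡ ε
  τ-ε = ε-unique (τ ε) (τ-nonzero ε≢0)
          (subst (λ u → Null (u ∷ τ ε ∷ [])) τ-1 (τ-Null (1# ∷ ε ∷ []) (1≢0 ∷ ε≢0 ∷ []) Null-1+ε))

  τ-preservesNull : PreservesNull τ
  τ-preservesNull = record { map-nonzero = τ-nonzero ; map-zero = τ-0 ; map-null = τ-Null }

  τ-ε^ : ∀ k → τ (ε^ k) ≡ ε^ k
  τ-ε^ zero    = τ-1
  τ-ε^ (suc k) = trans (τ-· ε (ε^ k)) (cong₂ _·_ τ-ε (τ-ε^ k))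

  τ-transpose : ∀ k {x y} → y ≡ ε^ k · τ x → x ≡ ε^ k · τ y
  τ-transpose k {x} {y} y≡ = ε^-flip k (begin
    τ y                  ≡⟨ cong τ y≡ ⟩
    τ (ε^ k · τ x)       ≡⟨ τ-· _ _ ⟩
    τ (ε^ k) · τ (τ x)   ≡⟨ cong₂ _·_ (τ-ε^ k) (τ-invol x) ⟩
    ε^ k · x             ∎)
    where open ≡-Reasoning

module SignProperties (T : Tract) {n : ℕ} where
  open TractProperties T
  open import Algebra.Properties.CommutativeSemigroup
    (CommutativeMonoid.commutativeSemigroup ·-commutativeMonoid) using () renaming (x∙yz≈y∙xz to ·-left-comm)

  countBelow-↭ : ∀ (b : Fin n) {xs ys} → xs ↭ ys → countBelow T b xs ≡ countBelow T b ys
  countBelow-↭ b Perm.refl         = refl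
  countBelow-↭ b (Perm.prep x p) with does (x <? b)
  ... | true  = cong suc (countBelow-↭ b p)
  ... | false = countBelow-↭ b p
  countBelow-↭ b (Perm.swap x y p) with does (x <? b) | does (y <? b)
  ... | true  | true  = cong (λ k → suc (suc k)) (countBelow-↭ b p)
  ... | true  | false = cong suc (countBelow-↭ b p)
  ... | false | true  = cong suc (countBelow-↭ b p)
  ... | false | false = countBelow-↭ b p
  countBelow-↭ b (Perm.trans p q) = trans (countBelow-↭ b p) (countBelow-↭ b q)

  sign-∷ : ∀ (b : Fin n) l → sign T (b ∷ l) ≡ ε^ countBelow T b l · sign T l
  sign-∷ b l = ε^-+ (countBelow T b l) (inversions T l)

  sign-swap : ∀ {a b : Fin n} m → a ≢ b → sign T (b ∷ a ∷ m) ≡ ε · sign T (a ∷ b ∷ m)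
  sign-swap {a} {b} m a≢b with Fin.<-cmp a b
  ... | tri< a<b _ b≮a rewrite dec-true (a <? b) a<b | dec-false (b <? a) b≮a =
    cong (λ k → ε · ε^ k) (x∙yz≈y∙xz (countBelow T b m) (countBelow T a m) (inversions T m))
  ... | tri≈ _ a≡b _ = ⊥-elim (a≢b a≡b)
  ... | tri> a≮b _ b<a rewrite dec-false (a <? b) a≮b | dec-true (b <? a) b<a =
    trans (cong ε^_ (x∙yz≈y∙xz (countBelow T b m) (countBelow T a m) (inversions T m))) (sym (ε·ε·-cancel _))

  sign-shift : ∀ {a : Fin n} l m → All (a ≢_) l → sign T (l ++ a ∷ m) ≡ ε^ length l · sign T (a ∷ l ++ m)
  sign-shift         []      m []           = sym (·-identityˡ _)
  sign-shift {a = a} (b ∷ l) m (a≢b ∷ a∉l) = begin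
    sign T (b ∷ l ++ a ∷ m)
      ≡⟨ sign-∷ b (l ++ a ∷ m) ⟩
    ε^ countBelow T b (l ++ a ∷ m) · sign T (l ++ a ∷ m)
      ≡⟨ cong₂ _·_ (cong ε^_ (countBelow-↭ b (shift a l m))) (sign-shift l m a∉l) ⟩
    ε^ countBelow T b (a ∷ l ++ m) · (ε^ length l · sign T (a ∷ l ++ m))
      ≡⟨ ·-left-comm _ _ _ ⟩
    ε^ length l · (ε^ countBelow T b (a ∷ l ++ m) · sign T (a ∷ l ++ m))
      ≡⟨ cong (ε^ length l ·_) (trans (sym (sign-∷ b (a ∷ l ++ m))) (sign-swap (l ++ m) a≢b)) ⟩
    ε^ length l · (ε · sign T (a ∷ b ∷ l ++ m))
      ≡⟨ trans (·-left-comm _ _ _) (sym (·-assoc ε _ _)) ⟩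
    ε^ suc (length l) · sign T (a ∷ b ∷ l ++ m)
      ∎
    where open ≡-Reasoning

  sign-move : ∀ {a : Fin n} P Q R → All (a ≢_) Q →
              sign T (P ++ Q ++ a ∷ R) ≡ ε^ length Q · sign T (P ++ a ∷ Q ++ R)
  sign-move         []      Q R a∉Q = sign-shift Q R a∉Q
  sign-move {a = a} (p ∷ P) Q R a∉Q = begin
    sign T (p ∷ P ++ Q ++ a ∷ R)
      ≡⟨ sign-∷ p (P ++ Q ++ a ∷ R) ⟩
    ε^ countBelow T p (P ++ Q ++ a ∷ R) · sign T (P ++ Q ++ a ∷ R)
      ≡⟨ cong₂ _·_ (cong ε^_ (countBelow-↭ p (++⁺ˡ P (shift a Q R)))) (sign-move P Q R a∉Q) ⟩
    ε^ countBelow T p (P ++ a ∷ Q ++ R) · (ε^ length Q · sign T (P ++ a ∷ Q ++ R))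
      ≡⟨ ·-left-comm _ _ _ ⟩
    ε^ length Q · (ε^ countBelow T p (P ++ a ∷ Q ++ R) · sign T (P ++ a ∷ Q ++ R))
      ≡⟨ cong (ε^ length Q ·_) (sym (sign-∷ p (P ++ a ∷ Q ++ R))) ⟩
    ε^ length Q · sign T (p ∷ P ++ a ∷ Q ++ R)
      ∎
    where open ≡-Reasoning

  sign-move-inside : ∀ {a : Fin n} Pre P Q R Post → All (a ≢_) Q →
                     sign T (Pre ++ (P ++ Q ++ a ∷ R) ++ Post) ≡ ε^ length Q · sign T (Pre ++ (P ++ a ∷ Q ++ R) ++ Post)
  sign-move-inside {a} Pre P Q R Post a∉Q = begin
    sign T (Pre ++ (P ++ Q ++ a ∷ R) ++ Post)      ≡⟨ cong (sign T) (regroup (Q ++ a ∷ R)) ⟩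
    sign T ((Pre ++ P) ++ (Q ++ a ∷ R) ++ Post)    ≡⟨ cong (λ l → sign T ((Pre ++ P) ++ l)) (Listₚ.++-assoc Q (a ∷ R) Post) ⟩
    sign T ((Pre ++ P) ++ Q ++ a ∷ R ++ Post)      ≡⟨ sign-move (Pre ++ P) Q (R ++ Post) a∉Q ⟩
    ε^ length Q · sign T ((Pre ++ P) ++ a ∷ Q ++ R ++ Post)
      ≡⟨ cong (λ l → ε^ length Q · sign T ((Pre ++ P) ++ a ∷ l)) (sym (Listₚ.++-assoc Q R Post)) ⟩
    ε^ length Q · sign T ((Pre ++ P) ++ (a ∷ Q ++ R) ++ Post)
      ≡⟨ cong (λ l → ε^ length Q · sign T l) (sym (regroup (a ∷ Q ++ R))) ⟩
    ε^ length Q · sign T (Pre ++ (P ++ a ∷ Q ++ R) ++ Post) ∎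
    where
    open ≡-Reasoning
    regroup : ∀ X → Pre ++ (P ++ X) ++ Post ≡ (Pre ++ P) ++ X ++ Post
    regroup X = trans (cong (Pre ++_) (Listₚ.++-assoc P X Post)) (sym (Listₚ.++-assoc Pre P (X ++ Post)))

  sign-removeAt-++ : ∀ {m} (v : Vec (Fin n) (suc m)) k w → Unique (toList v) →
                     ε^ toℕ k · sign T (toList (removeAt v k) ++ lookup v k ∷ w) ≡ ε^ m · sign T (toList v ++ w)
  sign-removeAt-++ {m} v k w dv with removeAt-split v k
  ... | P , Q , v≡ , v∖k≡ , |P| = begin
    ε^ toℕ k · sign T (toList (removeAt v k) ++ e ∷ w)  ≡⟨ cong (λ l → ε^ toℕ k · sign T (l ++ e ∷ w)) v∖k≡ ⟩
    ε^ toℕ k · sign T ((P ++ Q) ++ e ∷ w)               ≡⟨ cong (λ l → ε^ toℕ k · sign T l) (Listₚ.++-assoc P Q (e ∷ w)) ⟩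
    ε^ toℕ k · sign T (P ++ Q ++ e ∷ w)                 ≡⟨ cong (ε^ toℕ k ·_) (sign-move P Q w e∉Q) ⟩
    ε^ toℕ k · (ε^ length Q · sign T (P ++ e ∷ Q ++ w))  ≡⟨ sym (·-assoc _ _ _) ⟩
    (ε^ toℕ k · ε^ length Q) · sign T (P ++ e ∷ Q ++ w)  ≡⟨ cong₂ _·_ (trans (sym (ε^-+ (toℕ k) (length Q))) (cong ε^_ k+|Q|≡m))
                                                                   (cong (sign T) (sym (trans (cong (_++ w) v≡) (Listₚ.++-assoc P (e ∷ Q) w)))) ⟩
    ε^ m · sign T (toList v ++ w)                       ∎
    where
    open ≡-Reasoning
    e = lookup v k
    e∉Q : All (e ≢_) Q
    e∉Q = Allₚ.++⁻ʳ P (Unique-middle P (subst Unique v≡ dv))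
    k+|Q|≡m : toℕ k + length Q ≡ m
    k+|Q|≡m = begin
      toℕ k + length Q           ≡⟨ cong (_+ length Q) (sym |P|) ⟩
      length P + length Q        ≡⟨ sym (Listₚ.length-++ P) ⟩
      length (P ++ Q)            ≡⟨ cong length (sym v∖k≡) ⟩
      length (toList (removeAt v k)) ≡⟨ Vec.length-toList (removeAt v k) ⟩
      m                          ∎

  sign-removeAt-∷ : ∀ {m} u (v : Vec (Fin n) (suc m)) k → Unique (u ++ toList v) →
                    sign T (u ++ toList v) ≡ ε^ (length u + toℕ k) · sign T (lookup v k ∷ u ++ toList (removeAt v k))
  sign-removeAt-∷ u v k u++v-unique with removeAt-split v k
  ... | P , Q , v≡ , v∖k≡ , |P| = begin
    sign T (u ++ toList v)            ≡⟨ cong (sign T) u++v≡ ⟩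
    sign T ((u ++ P) ++ e ∷ Q)        ≡⟨ sign-move [] (u ++ P) Q e∉uP ⟩
    ε^ length (u ++ P) · sign T (e ∷ (u ++ P) ++ Q)
      ≡⟨ cong₂ (λ i l → ε^ i · sign T (e ∷ l)) (trans (Listₚ.length-++ u) (cong (length u +_) |P|))
                                              (trans (Listₚ.++-assoc u P Q) (cong (u ++_) (sym v∖k≡))) ⟩
    ε^ (length u + toℕ k) · sign T (e ∷ u ++ toList (removeAt v k)) ∎
    where
    open ≡-Reasoning
    e = lookup v k
    u++v≡ : u ++ toList v ≡ (u ++ P) ++ e ∷ Q
    u++v≡ = trans (cong (u ++_) v≡) (sym (Listₚ.++-assoc u P (e ∷ Q)))
    e∉uP : All (e ≢_) (u ++ P)
    e∉uP = Allₚ.++⁻ˡ (u ++ P) (Unique-middle (u ++ P) (subst Unique u++v≡ u++v-unique))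

module NullsetTransfer (T : Tract) where
  open TractProperties T

  drop0-nonzero : ∀ {xs ys} → Drop0 T xs ys → All (_≢ 0#) ys
  drop0-nonzero nil        = []
  drop0-nonzero (keep p d) = p ∷ drop0-nonzero d
  drop0-nonzero (drop _ d) = drop0-nonzero d

  drop0-++⁻ : ∀ xs {ys zs} → Drop0 T (xs ++ ys) zs →
              Σ (List Carrier) λ p → Σ (List Carrier) λ q → zs ≡ p ++ q × Drop0 T xs p × Drop0 T ys q
  drop0-++⁻ []       d = [] , _ , refl , nil , d
  drop0-++⁻ (x ∷ xs) (keep x≢0 d) with drop0-++⁻ xs d
  ... | p , q , refl , dp , dq = x ∷ p , q , refl , keep x≢0 dp , dq
  drop0-++⁻ (x ∷ xs) (drop x≡0 d) with drop0-++⁻ xs d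
  ... | p , q , refl , dp , dq = p , q , refl , drop x≡0 dp , dq

  drop0-++⁺ : ∀ {xs ys p q} → Drop0 T xs p → Drop0 T ys q → Drop0 T (xs ++ ys) (p ++ q)
  drop0-++⁺ nil          d' = d'
  drop0-++⁺ (keep x≢0 d) d' = keep x≢0 (drop0-++⁺ d d')
  drop0-++⁺ (drop x≡0 d) d' = drop x≡0 (drop0-++⁺ d d')

  record Corresponding {K : Set} (h : Carrier → Carrier) (L₁ L₂ : List (K × Carrier)) : Set where
    field
      unique₁ : Unique (map proj₁ L₁)
      unique₂ : Unique (map proj₁ L₂)
      forth   : ∀ {k v} → (k , v) ∈ L₁ → v ≢ 0# → ∃ λ v' → (k , v') ∈ L₂
      back    : ∀ {k v} → (k , v) ∈ L₂ → v ≡ 0# ⊎ ∃ λ v' → (k , v') ∈ L₁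
      image   : ∀ {k v v'} → (k , v) ∈ L₁ → (k , v') ∈ L₂ → v' ≡ h v

  drop0-all-zero : ∀ {K : Set} (L : List (K × Carrier)) → (∀ {k v} → (k , v) ∈ L → v ≡ 0#) → Drop0 T (map proj₂ L) []
  drop0-all-zero []            _        = nil
  drop0-all-zero ((k , v) ∷ L) all-zero = drop (all-zero (here refl)) (drop0-all-zero L (all-zero ∘ there))

  module _ {K : Set} {h : Carrier → Carrier} where

    corresponding-drop : ∀ {k : K} {v L₁ L₂} → Corresponding h ((k , v) ∷ L₁) L₂ → h 0# ≡ 0# → v ≡ 0# →
                         Corresponding h L₁ L₂
    corresponding-drop {k} {v} {L₁} {L₂} c h0≡0 v≡0 = record
      { unique₁ = Unique-++⁻ʳ (k ∷ []) unique₁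
      ; unique₂ = unique₂
      ; forth   = forth ∘ there
      ; back    = λ m → back′ m (back m)
      ; image   = image ∘ there }
      where
      open Corresponding c
      back′ : ∀ {k' v'} → (k' , v') ∈ L₂ → v' ≡ 0# ⊎ ∃ (λ w → (k' , w) ∈ (k , v) ∷ L₁) →
              v' ≡ 0# ⊎ ∃ λ w → (k' , w) ∈ L₁
      back′ m (inj₁ v'≡0)              = inj₁ v'≡0
      back′ m (inj₂ (_ , here refl))  = inj₁ (trans (image (here refl) m) (trans (cong h v≡0) h0≡0))
      back′ m (inj₂ (w , there m'))   = inj₂ (w , m')

    corresponding-remove : ∀ {k : K} {v v' L₁} A B → Corresponding h ((k , v) ∷ L₁) (A ++ (k , v') ∷ B) →
                           Corresponding h L₁ (A ++ B)
    corresponding-remove {k} {v' = v'} {L₁} A B c = record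
      { unique₁ = Unique-++⁻ʳ (k ∷ []) unique₁
      ; unique₂ = Unique-++⁻ʳ (k ∷ []) keys₂
      ; forth   = forth′
      ; back    = back′
      ; image   = λ m₁ m₂ → image (there m₁) (lift m₂) }
      where
      open Corresponding c
      keys₂ : Unique (k ∷ map proj₁ (A ++ B))
      keys₂ = subst (λ ks → Unique (k ∷ ks)) (sym (Listₚ.map-++ proj₁ A B))
                (Unique-shift (map proj₁ A) (subst Unique (Listₚ.map-++ proj₁ A ((k , v') ∷ B)) unique₂))
      k∉keys : ∀ {L : List (K × Carrier)} → Unique (k ∷ map proj₁ L) → ∀ {w} → (k , w) ∉ L
      k∉keys (k∉ ∷ _) m = All.lookup k∉ (∈-map⁺ proj₁ m) refl
      lift : ∀ {e} → e ∈ A ++ B → e ∈ A ++ (k , v') ∷ B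
      lift m with ∈-++⁻ A m
      ... | inj₁ m∈A = ∈-++⁺ˡ m∈A
      ... | inj₂ m∈B = ∈-++⁺ʳ A (there m∈B)
      forth′ : ∀ {k' w} → (k' , w) ∈ L₁ → w ≢ 0# → ∃ λ w' → (k' , w') ∈ A ++ B
      forth′ m w≢0 with forth (there m) w≢0
      ... | w' , m₂ with ∈-++⁻ A m₂
      ... | inj₁ m∈A         = w' , ∈-++⁺ˡ m∈A
      ... | inj₂ (here refl) = ⊥-elim (k∉keys unique₁ m)
      ... | inj₂ (there m∈B) = w' , ∈-++⁺ʳ A m∈B
      back′ : ∀ {k' w} → (k' , w) ∈ A ++ B → w ≡ 0# ⊎ ∃ λ w' → (k' , w') ∈ L₁
      back′ m with back (lift m)
      ... | inj₁ w≡0              = inj₁ w≡0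
      ... | inj₂ (_ , here refl)  = ⊥-elim (k∉keys keys₂ m)
      ... | inj₂ (w' , there m₁) = inj₂ (w' , m₁)

  module _ {K : Set} {h : Carrier → Carrier} (preserves : PreservesNull h) where
    open PreservesNull preserves

    drop0-transfer : ∀ {L₁ L₂ : List (K × Carrier)} {ys₁} → Corresponding h L₁ L₂ → Drop0 T (map proj₂ L₁) ys₁ →
                     Σ (List Carrier) λ ys₂ → Drop0 T (map proj₂ L₂) ys₂ × ys₂ ↭ map h ys₁
    drop0-transfer {[]} {L₂} c nil = [] , drop0-all-zero L₂ all-zero , ↭-refl
      where
      all-zero : ∀ {k v} → (k , v) ∈ L₂ → v ≡ 0#
      all-zero m with Corresponding.back c m
      ... | inj₁ v≡0 = v≡0
      ... | inj₂ (_ , ())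
    drop0-transfer {_ ∷ _} c (drop v≡0 d) = drop0-transfer (corresponding-drop c map-zero v≡0) d
    drop0-transfer {(k , v) ∷ L₁} {ys₁ = v ∷ ys₁} c (keep v≢0 d)
      with Corresponding.forth c (here refl) v≢0
    ... | v' , k,v'∈L₂ with ∈-∃++ k,v'∈L₂
    ... | A , B , refl with drop0-transfer (corresponding-remove A B c) d
    ... | ys₂ , d₂ , ys₂↭ with drop0-++⁻ (map proj₂ A) (subst (λ xs → Drop0 T xs ys₂) (Listₚ.map-++ proj₂ A B) d₂)
    ... | p , q , refl , dp , dq =
      p ++ v' ∷ q , drop0-L₂ , ↭-trans (shift v' p q) (subst (λ u → v' ∷ p ++ q ↭ u ∷ map h ys₁) v'≡hv (↭-prep v' ys₂↭))
      where
      v'≡hv : v' ≡ h v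
      v'≡hv = Corresponding.image c (here refl) k,v'∈L₂
      drop0-L₂ : Drop0 T (map proj₂ (A ++ (k , v') ∷ B)) (p ++ v' ∷ q)
      drop0-L₂ = subst (λ xs → Drop0 T xs (p ++ v' ∷ q)) (sym (Listₚ.map-++ proj₂ A ((k , v') ∷ B)))
                   (drop0-++⁺ dp (keep (subst (_≢ 0#) (sym v'≡hv) (map-nonzero v≢0)) dq))

    InN-transfer : ∀ {L₁ L₂ : List (K × Carrier)} → Corresponding h L₁ L₂ → InN T (map proj₂ L₁) → InN T (map proj₂ L₂)
    InN-transfer c (ys₁ , d₁ , null₁) with drop0-transfer c d₁
    ... | ys₂ , d₂ , ys₂↭ =
      ys₂ , d₂ , Null-↭ (Allₚ.map⁺ (All.map map-nonzero (drop0-nonzero d₁))) (↭-sym ys₂↭) (map-null ys₁ (drop0-nonzero d₁) null₁)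

    InN-tabulate-transfer :
      ∀ {m₁ m₂} {key₁ : Fin m₁ → K} {key₂ : Fin m₂ → K} {t₁ : Fin m₁ → Carrier} {t₂ : Fin m₂ → Carrier} →
      Injective _≡_ _≡_ key₁ → Injective _≡_ _≡_ key₂ →
      (∀ k₁ → t₁ k₁ ≡ 0# ⊎ ∃ λ k₂ → key₂ k₂ ≡ key₁ k₁) →
      (∀ k₂ → t₂ k₂ ≡ 0# ⊎ ∃ λ k₁ → key₁ k₁ ≡ key₂ k₂) →
      (∀ {k₁ k₂} → key₁ k₁ ≡ key₂ k₂ → t₂ k₂ ≡ h (t₁ k₁)) →
      InN T (toList (tabulate t₁)) → InN T (toList (tabulate t₂))
    InN-tabulate-transfer {key₁ = key₁} {key₂} {t₁} {t₂} key₁-inj key₂-inj support₁ support₂ match =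
      subst (InN T) (values t₂) ∘ InN-transfer correspondence ∘ subst (InN T) (sym (values t₁))
      where
      keyed : ∀ {m} → (Fin m → K) → (Fin m → Carrier) → List (K × Carrier)
      keyed key t = List.tabulate (λ i → key i , t i)

      values : ∀ {m} {key : Fin m → K} t → map proj₂ (keyed key t) ≡ toList (tabulate t)
      values t = trans (Listₚ.map-tabulate _ proj₂) (sym (toList-tabulate t))

      keys-unique : ∀ {m} {key : Fin m → K} {t} → Injective _≡_ _≡_ key → Unique (map proj₁ (keyed key t))
      keys-unique key-inj = subst Unique (sym (Listₚ.map-tabulate _ proj₁)) (Unique.tabulate⁺ key-inj)

      keyed-∈ : ∀ {m} {key : Fin m → K} {t k v} → (k , v) ∈ keyed key t → ∃ λ i → key i ≡ k × t i ≡ v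
      keyed-∈ m with ∈-tabulate⁻ m
      ... | i , refl = i , refl , refl

      keyed-∈-at : ∀ {m} {key : Fin m → K} {t} i {k} → key i ≡ k → (k , t i) ∈ keyed key t
      keyed-∈-at i refl = ∈-tabulate⁺ i

      correspondence : Corresponding h (keyed key₁ t₁) (keyed key₂ t₂)
      correspondence = record
        { unique₁ = keys-unique key₁-inj
        ; unique₂ = keys-unique key₂-inj
        ; forth   = forth
        ; back    = back
        ; image   = image }
        where
        forth : ∀ {k v} → (k , v) ∈ keyed key₁ t₁ → v ≢ 0# → ∃ λ v' → (k , v') ∈ keyed key₂ t₂
        forth m v≢0 with keyed-∈ m
        ... | k₁ , refl , refl with support₁ k₁
        ...   | inj₁ t₁≡0       = ⊥-elim (v≢0 t₁≡0)
        ...   | inj₂ (k₂ , key≡) = t₂ k₂ , keyed-∈-at k₂ key≡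
        back : ∀ {k v} → (k , v) ∈ keyed key₂ t₂ → v ≡ 0# ⊎ ∃ λ v' → (k , v') ∈ keyed key₁ t₁
        back m with keyed-∈ m
        ... | k₂ , refl , refl with support₂ k₂
        ...   | inj₁ t₂≡0       = inj₁ t₂≡0
        ...   | inj₂ (k₁ , key≡) = inj₂ (t₁ k₁ , keyed-∈-at k₁ key≡)
        image : ∀ {k v v'} → (k , v) ∈ keyed key₁ t₁ → (k , v') ∈ keyed key₂ t₂ → v' ≡ h v
        image m₁ m₂ with keyed-∈ m₁ | keyed-∈ m₂
        ... | k₁ , refl , refl | k₂ , key≡ , refl = match (sym key≡)

module FinTuples {n : ℕ} where
  open DecMembership (_≟_ {n}) using (_∈?_)

  Distinct : ∀ {m} → Vec (Fin n) m → Set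
  Distinct v = Unique (toList v)

  Repetition : ∀ {m} → Vec (Fin n) m → Set
  Repetition {m} v = ∃₂ λ (i j : Fin m) → toℕ i < toℕ j × lookup v i ≡ lookup v j

  repetition⇒¬distinct : ∀ {m} {v : Vec (Fin n) m} → Repetition v → ¬ Distinct v
  repetition⇒¬distinct {v = v} (i , j , i<j , v[i]≡v[j]) dv =
    ℕ.<-irrefl (cong toℕ (lookup-injective v dv v[i]≡v[j])) i<j

  distinct-or-repetition : ∀ {m} (v : Vec (Fin n) m) → Distinct v ⊎ Repetition v
  distinct-or-repetition []      = inj₁ []
  distinct-or-repetition (x ∷ v) with distinct-or-repetition v
  ... | inj₂ (i , j , i<j , e) = inj₂ (suc i , suc j , s≤s i<j , e)
  ... | inj₁ dv with x ∈? toList v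
  ...   | no x∉v  = inj₁ (Allₚ.¬Any⇒All¬ (toList v) x∉v ∷ dv)
  ...   | yes x∈v with ∈-toList⇒lookup v x∈v
  ...     | j , v[j]≡x = inj₂ (zero , suc j , s≤s z≤n , sym v[j]≡x)

  distinct⇒≤ : ∀ {m} {v : Vec (Fin n) m} → Distinct v → m ≤ n
  distinct⇒≤ {m} {v} dv with ℕ.≤-<-connex m n
  ... | inj₁ m≤n = m≤n
  ... | inj₂ n<m = ⊥-elim (repetition⇒¬distinct (Fin.pigeonhole n<m (lookup v)) dv)

  record Complementary {m k} (z : Vec (Fin n) m) (z' : Vec (Fin n) k) : Set where
    constructor complementary
    field enumerates : toList (z ++ᵛ z') ↭ allFin n

  complementary-distinct : ∀ {m k} {z : Vec (Fin n) m} {z' : Vec (Fin n) k} →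
                           Complementary z z' → Unique (toList z ++ toList z')
  complementary-distinct {z = z} {z'} (complementary p) =
    subst Unique (Vec.toList-++ z z') (Unique-resp-↭ (↭-sym p) (Unique.allFin⁺ n))

  complementary-covers : ∀ {m k} {z : Vec (Fin n) m} {z' : Vec (Fin n) k} →
                         Complementary z z' → ∀ e → e ∈ toList z ++ toList z'
  complementary-covers {z = z} {z'} (complementary p) e =
    subst (e ∈_) (Vec.toList-++ z z') (∈-resp-↭ (↭-sym p) (∈-allFin e))

  complementary-↭ : ∀ {m m' k k'} {z : Vec (Fin n) m} {z' : Vec (Fin n) k} {u : Vec (Fin n) m'} {u' : Vec (Fin n) k'} →
                    toList u ++ toList u' ↭ toList z ++ toList z' → Complementary z z' → Complementary u u'
  complementary-↭ {z = z} {z'} {u} {u'} u↭z (complementary p) = complementary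
    (subst (_↭ allFin n) (sym (Vec.toList-++ u u')) (↭-trans u↭z (subst (_↭ allFin n) (Vec.toList-++ z z') p)))

  complementary-sym : ∀ {m k} {z : Vec (Fin n) m} {z' : Vec (Fin n) k} → Complementary z z' → Complementary z' z
  complementary-sym {z = z} {z'} = complementary-↭ (++-comm (toList z') (toList z))

  complement : ∀ {m k} (z : Vec (Fin n) m) → Distinct z → m + k ≡ n → Σ (Vec (Fin n) k) (Complementary z)
  complement {m} {k} z dz m+k≡n =
    z' , complementary (subst (_↭ allFin n) (sym (trans (Vec.toList-++ z z') (cong (toList z ++_) z'≡rest))) z++rest↭)
    where
    outside? = λ e → ¬? (e ∈? toList z)
    rest = filter outside? (allFin n)
    z++rest↭ : toList z ++ rest ↭ allFin n
    z++rest↭ = ∼bag⇒↭ (unique∧set⇒bag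
      (Unique.++⁺ dz (Unique.filter⁺ outside? (Unique.allFin⁺ n))
                     (λ (e∈z , e∈rest) → proj₂ (∈-filter⁻ outside? {xs = allFin n} e∈rest) e∈z))
      (Unique.allFin⁺ n)
      (mk⇔ (λ _ → ∈-allFin _) covers))
      where
      covers : ∀ {e} → e ∈ allFin n → e ∈ toList z ++ rest
      covers {e} _ with e ∈? toList z
      ... | yes e∈z = ∈-++⁺ˡ e∈z
      ... | no  e∉z = ∈-++⁺ʳ (toList z) (∈-filter⁺ outside? (∈-allFin e) e∉z)
    |rest| : length rest ≡ k
    |rest| = ℕ.+-cancelˡ-≡ m _ _ (begin
      m + length rest              ≡⟨ cong (_+ length rest) (Vec.length-toList z) ⟨
      length (toList z) + length rest ≡⟨ Listₚ.length-++ (toList z) ⟨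
      length (toList z ++ rest)    ≡⟨ ↭-length z++rest↭ ⟩
      length (allFin n)            ≡⟨ Listₚ.length-tabulate _ ⟩
      n                            ≡⟨ m+k≡n ⟨
      m + k                        ∎)
      where open ≡-Reasoning
    z' = proj₁ (toList-length rest |rest|)
    z'≡rest = proj₂ (toList-length rest |rest|)

module GrassmannPlücker (T : Tract) (I : Involution T) {n : ℕ} where
  open TractProperties T
  open InvolutionProperties I
  open SignProperties T {n}
  open NullsetTransfer T
  open FinTuples {n}

  ZeroOnRepetitions : ∀ {m} → (Vec (Fin n) m → Carrier) → Set
  ZeroOnRepetitions f = ∀ v → ¬ Distinct v → f v ≡ 0#

  DecidableZero : ∀ {m} → (Vec (Fin n) m → Carrier) → Set
  DecidableZero f = ∀ v → Dec (f v ≡ 0#)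

  AlternatingOnRemoval : ∀ {m} → (Vec (Fin n) m → Carrier) → Set
  AlternatingOnRemoval {m} f = ∀ (y : Vec (Fin n) (suc m)) {i j} → toℕ i < toℕ j → lookup y i ≡ lookup y j →
                               ε^ suc (toℕ i) · f (removeAt y i) ≡ ε^ toℕ j · f (removeAt y j)

  -- A GP function and its dual both have this form, the context being a complement of v.
  SignedInContext : ∀ {m} → (Vec (Fin n) m → Carrier) → Set
  SignedInContext {m} f = ∀ (v : Vec (Fin n) m) → Distinct v → ∃₂ λ (Pre Post : List (Fin n)) → ∃ λ (c : Carrier) →
                        ∀ v' → toList v' ↭ toList v → f v' ≡ sign T (Pre ++ toList v' ++ Post) · c

  alternating : ∀ {m} {f : Vec (Fin n) m → Carrier} → ZeroOnRepetitions f → SignedInContext f → AlternatingOnRemoval f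
  alternating {f = f} zero-rep signed y {i} {j} i<j y[i]≡y[j] with removeAt-repeat y i<j y[i]≡y[j]
  ... | P , Q , R , y∖i≡ , y∖j≡ , i+|Q|≡j with distinct-or-repetition (removeAt y i)
  ...   | inj₂ rep = trans (cong (ε^ suc (toℕ i) ·_) (zero-rep _ (repetition⇒¬distinct rep)))
                     (trans (·-zeroʳ _) (sym (trans (cong (ε^ toℕ j ·_) (zero-rep _ y∖j-repeats)) (·-zeroʳ _))))
    where
    y∖j-repeats : ¬ Distinct (removeAt y j)
    y∖j-repeats d = repetition⇒¬distinct rep
      (Unique-resp-↭ (subst₂ _↭_ (sym y∖j≡) (sym y∖i≡) (++⁺ˡ P (↭-sym (shift _ Q R)))) d)
  ...   | inj₁ d with signed (removeAt y i) d
  ...     | Pre , Post , c , f≡ = begin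
    ε^ suc (toℕ i) · f (removeAt y i)
      ≡⟨ cong (ε^ suc (toℕ i) ·_) (trans (f≡ _ ↭-refl) (cong (λ l → sign T (Pre ++ l ++ Post) · c) y∖i≡)) ⟩
    ε^ suc (toℕ i) · (sign T (Pre ++ (P ++ Q ++ e ∷ R) ++ Post) · c)
      ≡⟨ cong (λ s → ε^ suc (toℕ i) · (s · c)) (sign-move-inside Pre P Q R Post e∉Q) ⟩
    ε^ suc (toℕ i) · ((ε^ length Q · S) · c)
      ≡⟨ solve 4 (λ a b s c → a ⊕ ((b ⊕ s) ⊕ c) ⊜ (a ⊕ b) ⊕ (s ⊕ c)) refl (ε^ suc (toℕ i)) (ε^ length Q) S c ⟩
    (ε^ suc (toℕ i) · ε^ length Q) · (S · c)
      ≡⟨ cong₂ _·_ (trans (sym (ε^-+ (suc (toℕ i)) (length Q))) (cong ε^_ i+|Q|≡j))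
                   (sym (trans (f≡ _ y∖j↭y∖i) (cong (λ l → sign T (Pre ++ l ++ Post) · c) y∖j≡))) ⟩
    ε^ toℕ j · f (removeAt y j) ∎
    where
    open ≡-Reasoning
    e = lookup y j
    S = sign T (Pre ++ (P ++ e ∷ Q ++ R) ++ Post)
    e∉Q : All (e ≢_) Q
    e∉Q = Allₚ.++⁻ˡ Q (Unique-middle Q (Unique-++⁻ʳ P (subst Unique y∖i≡ d)))
    y∖j↭y∖i : toList (removeAt y j) ↭ toList (removeAt y i)
    y∖j↭y∖i = subst₂ _↭_ (sym y∖j≡) (sym y∖i≡) (++⁺ˡ P (↭-sym (shift e Q R)))

  plückerTerm : ∀ {w r} → (Vec (Fin n) w → Carrier) → (Vec (Fin n) (suc r) → Carrier) →
                Vec (Fin n) (suc w) → Vec (Fin n) r → Fin (suc w) → Carrier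
  plückerTerm f g y x k = ε^ suc (toℕ k) · f (removeAt y k) · g (lookup y k ∷ x)

  plückerSum : ∀ {w r} → (Vec (Fin n) w → Carrier) → (Vec (Fin n) (suc r) → Carrier) →
               Vec (Fin n) (suc w) → Vec (Fin n) r → List Carrier
  plückerSum f g y x = toList (tabulate (plückerTerm f g y x))

  InN-all-zero : ∀ {m} (t : Fin m → Carrier) → (∀ k → t k ≡ 0#) → InN T (toList (tabulate t))
  InN-all-zero t t≡0 = [] , all-dropped t t≡0 , Null-0
    where
    all-dropped : ∀ {m} (t : Fin m → Carrier) → (∀ k → t k ≡ 0#) → Drop0 T (toList (tabulate t)) []
    all-dropped {zero}  t t≡0 = nil
    all-dropped {suc m} t t≡0 = drop (t≡0 zero) (all-dropped (t ∘ suc) (t≡0 ∘ suc))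

  InN-1+ε : ∀ u → Dec (u ≡ 0#) → InN T (u ∷ ε · u ∷ [])
  InN-1+ε u (yes u≡0) = [] , drop u≡0 (drop (trans (cong (ε ·_) u≡0) (·-zeroʳ ε)) nil) , Null-0
  InN-1+ε u (no u≢0)  = u ∷ ε · u ∷ [] , keep u≢0 (keep (·-nonzero ε≢0 u≢0) nil) ,
    subst Null (cong₂ (λ a b → a ∷ b ∷ []) (·-identityʳ u) (·-comm u ε))
               (Null-scale u (1# ∷ ε ∷ []) u≢0 (1≢0 ∷ ε≢0 ∷ []) Null-1+ε)

  -- If y[i] = y[j] (i < j), only the i-th and j-th terms can survive, and they are u and ε·u.
  plücker-repetition : ∀ {w r} {f : Vec (Fin n) w → Carrier} {g : Vec (Fin n) (suc r) → Carrier} →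
                       ZeroOnRepetitions f → AlternatingOnRemoval f → DecidableZero f → DecidableZero g →
                       ∀ y x → Repetition y → InN T (plückerSum f g y x)
  plücker-repetition {f = f} {g} f-zero f-alt f? g? y x (i , j , i<j , y[i]≡y[j]) =
    InN-tabulate-transfer id-preservesNull {key₁ = ends} {key₂ = id} ends-injective id
      (λ k → inj₂ (ends k , refl)) support match (InN-1+ε u u?)
    where
    i≢j : i ≢ j
    i≢j i≡j = ℕ.<-irrefl (cong toℕ i≡j) i<j
    u = ε^ toℕ j · f (removeAt y j) · g (lookup y j ∷ x)
    u? = Dec-zero-· (Dec-zero-· (no (ε^-nonzero (toℕ j))) (f? _)) (g? _)
    ends : Fin 2 → Fin _
    ends zero    = i
    ends (suc _) = j
    ends-injective : ∀ {a b} → ends a ≡ ends b → a ≡ b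
    ends-injective {zero}        {zero}        _   = refl
    ends-injective {zero}        {suc zero}    i≡j = ⊥-elim (i≢j i≡j)
    ends-injective {suc zero}    {zero}        j≡i = ⊥-elim (i≢j (sym j≡i))
    ends-injective {suc zero}    {suc zero}    _   = refl
    support : ∀ k → plückerTerm f g y x k ≡ 0# ⊎ ∃ λ e → ends e ≡ k
    support k with k ≟ i | k ≟ j
    ... | yes k≡i | _       = inj₂ (zero , sym k≡i)
    ... | no _    | yes k≡j = inj₂ (suc zero , sym k≡j)
    ... | no k≢i  | no k≢j  = inj₁ (trans (cong (λ a → ε^ suc (toℕ k) · a · g (lookup y k ∷ x)) (f-zero _ y∖k-repeats))
                                     (trans (cong (_· g (lookup y k ∷ x)) (·-zeroʳ _)) (·-zeroˡ _)))
      where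
      y∖k-repeats : ¬ Distinct (removeAt y k)
      y∖k-repeats d = i≢j (Fin.punchOut-injective k≢i k≢j (lookup-injective (removeAt y k) d
        (trans (Vec.removeAt-punchOut y k≢i) (trans y[i]≡y[j] (sym (Vec.removeAt-punchOut y k≢j))))))
    match : ∀ {e k} → ends e ≡ k → plückerTerm f g y x k ≡ lookup (u ∷ ε · u ∷ []) e
    match {zero}     refl = cong₂ (λ a b → a · g (b ∷ x)) (f-alt y i<j y[i]≡y[j]) y[i]≡y[j]
    match {suc zero} refl = trans (cong (_· g (lookup y j ∷ x)) (·-assoc ε _ _)) (·-assoc ε _ _)

  Quot-intro : ∀ {w r} {f : Vec (Fin n) w → Carrier} {g : Vec (Fin n) (suc r) → Carrier} →
               ZeroOnRepetitions f → AlternatingOnRemoval f → DecidableZero f → ZeroOnRepetitions g → DecidableZero g →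
               (∀ y x → Distinct y → Distinct x → InN T (plückerSum f g y x)) → Quot T f g
  Quot-intro {f = f} f-zero f-alt f? g-zero g? distinct-case y x with distinct-or-repetition x
  ... | inj₂ rep = InN-all-zero _ λ k →
    trans (cong (ε^ suc (toℕ k) · f (removeAt y k) ·_) (g-zero (lookup y k ∷ x) λ { (_ ∷ dx) → repetition⇒¬distinct rep dx }))
          (·-zeroʳ _)
  ... | inj₁ dx with distinct-or-repetition y
  ...   | inj₂ rep = plücker-repetition f-zero f-alt f? g? y x rep
  ...   | inj₁ dy  = distinct-case y x dy dx

  GP-zero-on-repetitions : ∀ {r} {φ : Vec (Fin n) r → Carrier} → IsGP T φ → ZeroOnRepetitions φ
  GP-zero-on-repetitions gp v ¬dv with distinct-or-repetition v
  ... | inj₁ dv                       = ⊥-elim (¬dv dv)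
  ... | inj₂ (i , j , i<j , v[i]≡v[j]) = IsGP.alt-zero gp v i j (λ i≡j → ℕ.<-irrefl (cong toℕ i≡j) i<j) v[i]≡v[j]

  GP-rank≤n : ∀ {r} {φ : Vec (Fin n) r → Carrier} → IsGP T φ → r ≤ n
  GP-rank≤n gp with IsGP.nonzero gp
  ... | v , φv≢0 with distinct-or-repetition v
  ...   | inj₁ dv  = distinct⇒≤ dv
  ...   | inj₂ rep = ⊥-elim (φv≢0 (GP-zero-on-repetitions gp v (repetition⇒¬distinct rep)))

  -- Pick w ∷ w' with φ(w ∷ w') ≠ 0: the first term of the Plücker relation for (w ∷ v, w') is
  -- ε · φ(v) · φ(w ∷ w'), and its Drop0 evidence records whether it is zero.
  GP-decidable-zero : ∀ {r} {φ : Vec (Fin n) r → Carrier} → IsGP T φ → DecidableZero φ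
  GP-decidable-zero {zero} gp [] with IsGP.nonzero gp
  ... | [] , φ[]≢0 = no φ[]≢0
  GP-decidable-zero {suc r} {φ} gp v with IsGP.nonzero gp
  ... | w ∷ w' , φw≢0 with IsGP.GP gp (w ∷ v) w'
  ...   | _ , keep t≢0 _ , _ = no λ φv≡0 → t≢0 (trans (cong (λ a → ε^ 1 · a · φ (w ∷ w')) φv≡0)
                                             (trans (cong (_· φ (w ∷ w')) (·-zeroʳ _)) (·-zeroˡ _)))
  ...   | _ , drop t≡0 _ , _ = yes (x·y≡0⇒x≡0 (ε^-nonzero 1) (trans (·-comm _ _) (x·y≡0⇒x≡0 φw≢0 t≡0)))

  -- IsDual with the rank of ψ an arbitrary s (s + r ≡ n is supplied where needed), so that it can be matched on.
  record Dual {r s} (φ : Vec (Fin n) r → Carrier) (ψ : Vec (Fin n) s → Carrier) : Set where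
    field
      on-complement : ∀ {z z'} → Complementary z z' → ψ z ≡ sign T (toList (z ++ᵛ z')) · τ (φ z')
      otherwise     : ∀ z → (∀ (z' : Vec (Fin n) r) → ¬ Complementary z z') → ψ z ≡ 0#

  IsDual⇒Dual : ∀ {r} {φ : Vec (Fin n) r → Carrier} {ψ} → IsDual T I φ ψ → Dual φ ψ
  IsDual⇒Dual d = record
    { on-complement = λ (complementary p) → IsDual.on-complement d _ _ p
    ; otherwise     = λ z ¬p → IsDual.otherwise d z (λ z' → ¬p z' ∘ complementary) }

  dual-zero-on-repetitions : ∀ {r s} {φ : Vec (Fin n) r → Carrier} {ψ : Vec (Fin n) s → Carrier} →
                             Dual φ ψ → ZeroOnRepetitions ψ
  dual-zero-on-repetitions dual z ¬dz = Dual.otherwise dual z λ z' p →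
    ¬dz (Unique-++⁻ˡ (toList z) (complementary-distinct p))

  module _ {r s} {φ : Vec (Fin n) r → Carrier} {ψ : Vec (Fin n) s → Carrier}
           (gp : IsGP T φ) (dual : Dual φ ψ) (s+r≡n : s + r ≡ n) where
    open Dual dual

    dual-decidable-zero : DecidableZero ψ
    dual-decidable-zero z with distinct-or-repetition z
    ... | inj₂ rep = yes (dual-zero-on-repetitions dual z (repetition⇒¬distinct rep))
    ... | inj₁ dz with complement z dz s+r≡n
    ...   | z' , p with GP-decidable-zero gp z'
    ...     | yes φz'≡0 = yes (trans (on-complement p) (trans (cong (λ a → _ · τ a) φz'≡0) (trans (cong (_ ·_) τ-0) (·-zeroʳ _))))
    ...     | no φz'≢0  = no λ ψz≡0 →
      ·-nonzero (ε^-nonzero (inversions T (toList (z ++ᵛ z')))) (τ-nonzero φz'≢0) (trans (sym (on-complement p)) ψz≡0)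

    dual-signed : SignedInContext ψ
    dual-signed z dz with complement z dz s+r≡n
    ... | z' , p = [] , toList z' , τ (φ z') , λ v v↭z →
      trans (on-complement (complementary-↭ (++⁺ʳ (toList z') v↭z) p))
            (cong (λ l → sign T l · τ (φ z')) (Vec.toList-++ v z'))

    primal-signed : SignedInContext φ
    primal-signed z dz with complement z dz (trans (ℕ.+-comm r s) s+r≡n)
    ... | z' , p = toList z' , [] , τ (ψ z') , λ v v↭z →
      trans (τ-transpose (inversions T (toList (z' ++ᵛ v)))
                         (on-complement (complementary-↭ (++⁺ˡ (toList z') v↭z) (complementary-sym p))))
            (cong (λ l → sign T l · τ (ψ z')) (trans (Vec.toList-++ z' v) (cong (toList z' ++_) (sym (Listₚ.++-identityʳ _)))))

  -- c collects the signs of moving a common element e to the front of ys ++ x and of xs ++ y.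
  module _ {r w a b} {μ : Vec (Fin n) (suc r) → Carrier} {ν : Vec (Fin n) w → Carrier}
           {μ* : Vec (Fin n) a → Carrier} {ν* : Vec (Fin n) (suc b) → Carrier}
           (μ-zero : ZeroOnRepetitions μ) (μ-dual : Dual μ μ*) (ν-dual : Dual ν ν*)
           {y : Vec (Fin n) (suc w)} {x : Vec (Fin n) r} {ys : Vec (Fin n) (suc a)} {xs : Vec (Fin n) b}
           (ys-x : Complementary ys x) (xs-y : Complementary xs y) where

    private
      primal = plückerTerm ν μ y x
      dual   = plückerTerm μ* ν* ys xs
      S₁ = sign T (toList (ys ++ᵛ x))
      S₂ = sign T (toList (xs ++ᵛ y))
      c  = ε^ a · ε^ b · S₁ · S₂

    c·c≡1 : c · c ≡ 1#
    c·c≡1 = begin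
      c · c
        ≡⟨ solve 4 (λ p q s t → (((p ⊕ q) ⊕ s) ⊕ t) ⊕ (((p ⊕ q) ⊕ s) ⊕ t) ⊜ (((p ⊕ p) ⊕ (q ⊕ q)) ⊕ (s ⊕ s)) ⊕ (t ⊕ t))
                 refl (ε^ a) (ε^ b) S₁ S₂ ⟩
      (ε^ a · ε^ a) · (ε^ b · ε^ b) · (S₁ · S₁) · (S₂ · S₂)
        ≡⟨ cong₂ _·_ (cong₂ _·_ (cong₂ _·_ (ε^-square a) (ε^-square b)) (ε^-square (inversions T (toList (ys ++ᵛ x))))) (ε^-square (inversions T (toList (xs ++ᵛ y)))) ⟩
      1# · 1# · 1# · 1# ≡⟨ trans (·-identityʳ _) (trans (·-identityʳ _) (·-identityʳ _)) ⟩
      1# ∎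
      where open ≡-Reasoning

    c≢0 : c ≢ 0#
    c≢0 c≡0 = 1≢0 (trans (sym c·c≡1) (trans (cong (_· c) c≡0) (·-zeroˡ c)))

    μ*-at-removeAt : ∀ k → ε^ toℕ k · μ* (removeAt ys k) ≡ ε^ a · S₁ · τ (μ (lookup ys k ∷ x))
    μ*-at-removeAt k = begin
      ε^ toℕ k · μ* (removeAt ys k)
        ≡⟨ cong (ε^ toℕ k ·_) (Dual.on-complement μ-dual
             (complementary-↭ (↭-trans (shift e _ _) (++⁺ʳ (toList x) (removeAt-↭ ys k))) ys-x)) ⟩
      ε^ toℕ k · (sign T (toList (removeAt ys k ++ᵛ e ∷ x)) · τ (μ (e ∷ x)))
        ≡⟨ sym (·-assoc _ _ _) ⟩
      ε^ toℕ k · sign T (toList (removeAt ys k ++ᵛ e ∷ x)) · τ (μ (e ∷ x))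
        ≡⟨ cong (λ l → ε^ toℕ k · sign T l · τ (μ (e ∷ x))) (Vec.toList-++ (removeAt ys k) (e ∷ x)) ⟩
      ε^ toℕ k · sign T (toList (removeAt ys k) ++ e ∷ toList x) · τ (μ (e ∷ x))
        ≡⟨ cong (_· τ (μ (e ∷ x))) (sign-removeAt-++ ys k (toList x) ys-distinct) ⟩
      ε^ a · sign T (toList ys ++ toList x) · τ (μ (e ∷ x))
        ≡⟨ cong (λ l → ε^ a · sign T l · τ (μ (e ∷ x))) (sym (Vec.toList-++ ys x)) ⟩
      ε^ a · S₁ · τ (μ (e ∷ x)) ∎
      where
      open ≡-Reasoning
      e = lookup ys k
      ys-distinct = Unique-++⁻ˡ (toList ys) (complementary-distinct ys-x)

    ν*-at-cons : ∀ k' → ν* (lookup y k' ∷ xs) ≡ ε^ b · ε^ toℕ k' · S₂ · τ (ν (removeAt y k'))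
    ν*-at-cons k' = begin
      ν* (e ∷ xs)
        ≡⟨ Dual.on-complement ν-dual
             (complementary-↭ (↭-trans (↭-sym (shift e _ _)) (++⁺ˡ (toList xs) (removeAt-↭ y k'))) xs-y) ⟩
      sign T (e ∷ toList (xs ++ᵛ removeAt y k')) · τ (ν (removeAt y k'))
        ≡⟨ cong (λ l → sign T (e ∷ l) · τ (ν (removeAt y k'))) (Vec.toList-++ xs (removeAt y k')) ⟩
      sign T (e ∷ toList xs ++ toList (removeAt y k')) · τ (ν (removeAt y k'))
        ≡⟨ cong (_· τ (ν (removeAt y k'))) (ε^-flip (length (toList xs) + toℕ k')
             (trans (cong (sign T) (Vec.toList-++ xs y)) (sign-removeAt-∷ (toList xs) y k' (complementary-distinct xs-y)))) ⟩
      ε^ (length (toList xs) + toℕ k') · S₂ · τ (ν (removeAt y k'))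
        ≡⟨ cong (λ p → p · S₂ · τ (ν (removeAt y k'))) (trans (cong (λ l → ε^ (l + toℕ k')) (Vec.length-toList xs)) (ε^-+ b (toℕ k'))) ⟩
      ε^ b · ε^ toℕ k' · S₂ · τ (ν (removeAt y k')) ∎
      where
      open ≡-Reasoning
      e = lookup y k'

    dual-term : ∀ {k k'} → lookup ys k ≡ lookup y k' → dual k ≡ c · τ (primal k')
    dual-term {k} {k'} ys[k]≡y[k'] = begin
      ε^ suc (toℕ k) · μ* (removeAt ys k) · ν* (lookup ys k ∷ xs)
        ≡⟨ cong (_· ν* (lookup ys k ∷ xs)) (·-assoc ε (ε^ toℕ k) _) ⟩
      ε · (ε^ toℕ k · μ* (removeAt ys k)) · ν* (lookup ys k ∷ xs)
        ≡⟨ cong₂ (λ p q → ε · p · q) (μ*-at-removeAt k) (cong (λ e → ν* (e ∷ xs)) ys[k]≡y[k']) ⟩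
      ε · (ε^ a · S₁ · τ (μ (lookup ys k ∷ x))) · ν* (e ∷ xs)
        ≡⟨ cong₂ (λ e' q → ε · (ε^ a · S₁ · τ (μ (e' ∷ x))) · q) ys[k]≡y[k'] (ν*-at-cons k') ⟩
      ε · (ε^ a · S₁ · τ (μ (e ∷ x))) · (ε^ b · ε^ toℕ k' · S₂ · τ (ν (removeAt y k')))
        ≡⟨ solve 8 (λ E A B K s₁ s₂ m v → (E ⊕ ((A ⊕ s₁) ⊕ m)) ⊕ (((B ⊕ K) ⊕ s₂) ⊕ v) ⊜ (((A ⊕ B) ⊕ s₁) ⊕ s₂) ⊕ (((E ⊕ K) ⊕ v) ⊕ m))
                 refl ε (ε^ a) (ε^ b) (ε^ toℕ k') S₁ S₂ (τ (μ (e ∷ x))) (τ (ν (removeAt y k'))) ⟩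
      c · (ε · ε^ toℕ k' · τ (ν (removeAt y k')) · τ (μ (e ∷ x)))
        ≡⟨ cong (c ·_) (sym τ-primal) ⟩
      c · τ (primal k') ∎
      where
      open ≡-Reasoning
      e = lookup y k'
      τ-primal : τ (primal k') ≡ ε · ε^ toℕ k' · τ (ν (removeAt y k')) · τ (μ (e ∷ x))
      τ-primal = trans (τ-· _ _) (cong (_· τ (μ (e ∷ x))) (trans (τ-· _ _) (cong (_· τ (ν (removeAt y k'))) (τ-ε^ (suc (toℕ k'))))))

    primal-support : ∀ k' → primal k' ≡ 0# ⊎ ∃ λ k → lookup ys k ≡ lookup y k'
    primal-support k' with ∈-++⁻ (toList ys) (complementary-covers ys-x (lookup y k'))
    ... | inj₁ ∈ys = inj₂ (∈-toList⇒lookup ys ∈ys)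
    ... | inj₂ ∈x  = inj₁ (trans (cong (ε^ suc (toℕ k') · ν (removeAt y k') ·_)
                                       (μ-zero (lookup y k' ∷ x) λ { (e∉x ∷ _) → All.lookup e∉x ∈x refl }))
                                 (·-zeroʳ _))

    dual-support : ∀ k → dual k ≡ 0# ⊎ ∃ λ k' → lookup y k' ≡ lookup ys k
    dual-support k with ∈-++⁻ (toList xs) (complementary-covers xs-y (lookup ys k))
    ... | inj₂ ∈y  = inj₂ (∈-toList⇒lookup y ∈y)
    ... | inj₁ ∈xs = inj₁ (trans (cong (ε^ suc (toℕ k) · μ* (removeAt ys k) ·_)
                                       (dual-zero-on-repetitions ν-dual (lookup ys k ∷ xs) λ { (e∉xs ∷ _) → All.lookup e∉xs ∈xs refl }))
                                 (·-zeroʳ _))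

    plücker-dual : InN T (plückerSum ν μ y x) ⇔ InN T (plückerSum μ* ν* ys xs)
    plücker-dual = mk⇔
      (InN-tabulate-transfer (∘-preservesNull (·-preservesNull c≢0) τ-preservesNull)
        y-injective ys-injective primal-support dual-support (dual-term ∘ sym))
      (InN-tabulate-transfer (∘-preservesNull τ-preservesNull (·-preservesNull c≢0))
        ys-injective y-injective dual-support primal-support primal-term)
      where
      y-injective = lookup-injective y (Unique-++⁻ʳ (toList xs) (complementary-distinct xs-y))
      ys-injective = lookup-injective ys (Unique-++⁻ˡ (toList ys) (complementary-distinct ys-x))
      primal-term : ∀ {k k'} → lookup ys k ≡ lookup y k' → primal k' ≡ τ (c · dual k)
      primal-term {k} {k'} ys[k]≡y[k'] = sym (begin
        τ (c · dual k)              ≡⟨ cong (λ t → τ (c · t)) (dual-term ys[k]≡y[k']) ⟩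
        τ (c · (c · τ (primal k'))) ≡⟨ cong τ (trans (sym (·-assoc c c _)) (trans (cong (_· τ (primal k')) c·c≡1) (·-identityˡ _))) ⟩
        τ (τ (primal k'))           ≡⟨ τ-invol _ ⟩
        primal k'                   ∎)
        where open ≡-Reasoning

  dual-quotient : ∀ {r w a b} {μ : Vec (Fin n) r → Carrier} {ν : Vec (Fin n) w → Carrier}
                  {μ* : Vec (Fin n) a → Carrier} {ν* : Vec (Fin n) b → Carrier} →
                  a + r ≡ n → b + w ≡ n → IsGP T μ → IsGP T ν → Dual μ μ* → Dual ν ν* →
                  Quot T ν μ → Quot T μ* ν*
  dual-quotient {b = zero} _ _ _ _ _ _ _ = tt
  dual-quotient {w = w} {a} {suc b} {ν = ν} {μ*} {ν*} a+r≡n b+w≡n μ-gp ν-gp μ-dual ν-dual q =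
    Quot-intro (dual-zero-on-repetitions μ-dual)
               (alternating (dual-zero-on-repetitions μ-dual) (dual-signed μ-gp μ-dual a+r≡n))
               (dual-decidable-zero μ-gp μ-dual a+r≡n)
               (dual-zero-on-repetitions ν-dual)
               (dual-decidable-zero ν-gp ν-dual b+w≡n)
               (λ ys xs dys dxs → via-complements ys xs dys dxs a+r≡n μ-gp μ-dual q)
    where
    via-complements : ∀ ys xs → Distinct ys → Distinct xs → ∀ {r} {μ : Vec (Fin n) r → Carrier} →
                      a + r ≡ n → IsGP T μ → Dual μ μ* → Quot T ν μ → InN T (plückerSum μ* ν* ys xs)
    via-complements ys xs dys dxs {zero}  a+0≡n _ _ _ =
      ⊥-elim (ℕ.<-irrefl (trans (sym (ℕ.+-identityʳ a)) a+0≡n) (distinct⇒≤ dys))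
    via-complements ys xs dys dxs {suc r} a+r≡n μ-gp μ-dual q
      with complement ys dys (trans (sym (ℕ.+-suc a r)) a+r≡n) | complement xs dxs (trans (ℕ.+-suc b w) b+w≡n)
    ... | x , ys-x | y , xs-y =
      Equivalence.to (plücker-dual (GP-zero-on-repetitions μ-gp) μ-dual ν-dual ys-x xs-y) (q y x)

  quotient-of-duals : ∀ {r w a b} {μ : Vec (Fin n) r → Carrier} {ν : Vec (Fin n) w → Carrier}
                      {μ* : Vec (Fin n) a → Carrier} {ν* : Vec (Fin n) b → Carrier} →
                      a + r ≡ n → b + w ≡ n → IsGP T μ → IsGP T ν → Dual μ μ* → Dual ν ν* →
                      Quot T μ* ν* → Quot T ν μ
  quotient-of-duals {zero} _ _ _ _ _ _ _ = tt
  quotient-of-duals {suc r} {w} {a} {μ = μ} {ν} {μ*} a+r≡n b+w≡n μ-gp ν-gp μ-dual ν-dual q =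
    Quot-intro (GP-zero-on-repetitions ν-gp)
               (alternating (GP-zero-on-repetitions ν-gp) (primal-signed ν-gp ν-dual b+w≡n))
               (GP-decidable-zero ν-gp)
               (GP-zero-on-repetitions μ-gp)
               (GP-decidable-zero μ-gp)
               (λ y x dy dx → via-complements y x dy dx b+w≡n ν-dual q)
    where
    via-complements : ∀ y x → Distinct y → Distinct x → ∀ {b} {ν* : Vec (Fin n) b → Carrier} →
                      b + w ≡ n → Dual ν ν* → Quot T μ* ν* → InN T (plückerSum ν μ y x)
    via-complements y x dy dx {zero}  w≡n _ _ = ⊥-elim (ℕ.<-irrefl w≡n (distinct⇒≤ dy))
    via-complements y x dy dx {suc b} b+w≡n ν-dual q
      with complement x dx (trans (ℕ.+-comm r (suc a)) (trans (sym (ℕ.+-suc a r)) a+r≡n))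
         | complement y dy (trans (ℕ.+-comm (suc w) b) (trans (ℕ.+-suc b w) b+w≡n))
    ... | ys , x-ys | xs , y-xs =
      Equivalence.from (plücker-dual (GP-zero-on-repetitions μ-gp) μ-dual ν-dual (complementary-sym x-ys) (complementary-sym y-xs))
                       (q ys xs)

proposition2p10 : (T : Tract) (I : Involution T) (n r w : ℕ)
    (μ : Vec (Fin n) r → Tract.Carrier T) (ν : Vec (Fin n) w → Tract.Carrier T)
    (μ* : Vec (Fin n) (n ∸ r) → Tract.Carrier T) (ν* : Vec (Fin n) (n ∸ w) → Tract.Carrier T) →
    IsGP T μ → IsGP T ν → IsDual T I μ μ* → IsDual T I ν ν* →
    (Quot T ν μ ⇔ Quot T μ* ν*)
proposition2p10 T I n r w μ ν μ* ν* μ-gp ν-gp μ-dual ν-dual =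
  mk⇔ (dual-quotient     μ-rank ν-rank μ-gp ν-gp (IsDual⇒Dual μ-dual) (IsDual⇒Dual ν-dual))
      (quotient-of-duals μ-rank ν-rank μ-gp ν-gp (IsDual⇒Dual μ-dual) (IsDual⇒Dual ν-dual))
  where
  open GrassmannPlücker T I {n}
  μ-rank = ℕ.m∸n+n≡m (GP-rank≤n μ-gp)
  ν-rank = ℕ.m∸n+n≡m (GP-rank≤n ν-gp)
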